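{- Let $\Lambda=\{\lambda_0=0<\lambda_1<\dots\}$ be a numerical semigroup different from $\mathbb N$, with conductor $c$, rank $k$ and set of left elements $L(\Lambda)=\{\lambda_0,\dots,\lambda_{k-1}\}$. Let $\Sigma=\Sigma_0\Sigma_1\dots\Sigma_{2c-1}$ be the bitstream with $\Sigma_i=0$ if $i\in L(\Lambda)+L(\Lambda)=\{a+b: a,b\in L(\Lambda)\}$ and $\Sigma_i=1$ otherwise. Let $G=G_0\dots G_{c-1}$ be the gap bitstream and $S=S_0\dots S_{c-1}$ the seed bitstream of $\Lambda$. Then $$G_0G_1\dots G_{c-2}=\Sigma_1\dots\Sigma_{c-1},\qquad G_{c-1}=0,\qquad S_0S_1\dots S_{c-1}=\Sigma_c\Sigma_{c+1}\dots\Sigma_{2c-1}.$$ Equivalently, writing $\mathrm{int}(\Sigma)=\sum_{i=0}^{2c-1}\Sigma_i2^i$, one has $G=\big((\mathrm{int}(\Sigma)\bmod 2^c)//2\big)_b$ and $S=\big(\mathrm{int}(\Sigma)//2^c\big)_b$, where $a//b$ and $a\bmod b$ are the quotient and remainder of integer division.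
   Context: A numerical semigroup is a cofinite submonoid of $\mathbb N$, with elements $\lambda_0=0<\lambda_1<\dots$. The genus $g$ is the number of gaps (elements of $\mathbb N\setminus\Lambda$), the conductor $c$ is the largest gap plus one, the rank is $k=c-g$ (so $\lambda_k=c$), and the left elements are $\lambda_0,\dots,\lambda_{k-1}$ (the elements of $\Lambda$ smaller than $c$). For $p<k$, an element $\lambda_s\ge c$ of $\Lambda$ is an order-$p$ seed if $\lambda_s+\lambda_p\neq\lambda_i+\lambda_j$ for all $p<i\le j<s$. The gap bitstream is $G(\Lambda)=G_0\dots G_{c-1}$ with $G_i=0$ if $i+1\in\Lambda$ and $G_i=1$ otherwise. The seed bitstream is $S(\Lambda)=S_0\dots S_{c-1}$ where, for $0\le i\le c-1$, letting $j\in\{0,\dots,k-1\}$ be the unique index with $\lambda_j\le i<\lambda_{j+1}$, $S_i=1$ if $c+i-\lambda_j$ is an order-$j$ seed of $\Lambda$ and $S_i=0$ otherwise. For $n\in\mathbb N$, $(n)_b=a_0a_1\dots a_\ell$ denotes the binary representation $n=\sum a_i2^i$ (least significant bit first); bitstreams differing only by trailing zeros are identified. -}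

module Defs where

open import Data.Nat using (ℕ; zero; suc; _+_; _∸_; _≤_; _<_)
open import Data.Bool using (Bool; true; false)
open import Data.Product using (Σ; ∃; _×_; _,_)
open import Relation.Nullary using (¬_)
open import Relation.Binary.PropositionalEquality using (_≡_; _≢_)

record NumericalSemigroup : Set where
  field
    mem      : ℕ → Bool
    mem-0    : mem 0 ≡ true
    mem-+    : ∀ m n → mem m ≡ true → mem n ≡ true → mem (m + n) ≡ true
    cofinite : ∃ λ N → ∀ n → N ≤ n → mem n ≡ true

open NumericalSemigroup public

_∈Λ_ : ℕ → NumericalSemigroup → Set
x ∈Λ Λ = mem Λ x ≡ true

countBelow : NumericalSemigroup → ℕ → ℕ
countBelow Λ zero = 0
countBelow Λ (suc x) with mem Λ x
... | true  = suc (countBelow Λ x)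
... | false = countBelow Λ x

gapsBelow : NumericalSemigroup → ℕ → ℕ
gapsBelow Λ zero = 0
gapsBelow Λ (suc x) with mem Λ x
... | true  = gapsBelow Λ x
... | false = suc (gapsBelow Λ x)

-- Nth Λ j x  :  λ_j = x  (x is the j-th element of Λ, counting from λ_0 = 0)
Nth : NumericalSemigroup → ℕ → ℕ → Set
Nth Λ j x = x ∈Λ Λ × countBelow Λ x ≡ j

-- c is the conductor: largest gap plus one (Λ ≠ ℕ, so there is a gap)
IsConductor : NumericalSemigroup → ℕ → Set
IsConductor Λ c =
  Σ ℕ λ g → (mem Λ g ≡ false) × (c ≡ suc g) × (∀ n → c ≤ n → n ∈Λ Λ)

-- genus (number of gaps; all gaps are below the conductor c) and rank k = c - g
genus : NumericalSemigroup → ℕ → ℕ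
genus Λ c = gapsBelow Λ c

rank : NumericalSemigroup → ℕ → ℕ
rank Λ c = c ∸ genus Λ c

OrderSeed : NumericalSemigroup → ℕ → ℕ → ℕ → Set
OrderSeed Λ c p x =
  p < rank Λ c × x ∈Λ Λ × c ≤ x ×
  (∀ s a i j y z → Nth Λ s x → Nth Λ p a → Nth Λ i y → Nth Λ j z →
     p < i → i ≤ j → j < s → x + a ≢ y + z)

-- Bits, expressed as propositions "the bit equals 1".

-- G_i = 1  iff  i+1 ∉ Λ
GapBit : NumericalSemigroup → ℕ → Set
GapBit Λ i = mem Λ (suc i) ≡ false

-- S_i = 1  iff  c + i - λ_j is an order-j seed, where λ_j ≤ i < λ_{j+1}
SeedBit : NumericalSemigroup → ℕ → ℕ → Set
SeedBit Λ c i =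
  Σ ℕ λ j → Σ ℕ λ a → Σ ℕ λ b →
    Nth Λ j a × Nth Λ (suc j) b × a ≤ i × i < b × OrderSeed Λ c j (c + i ∸ a)

-- i ∈ L(Λ) + L(Λ), where L(Λ) = elements of Λ smaller than c
InLeftSumset : NumericalSemigroup → ℕ → ℕ → Set
InLeftSumset Λ c i =
  Σ ℕ λ a → Σ ℕ λ b → a ∈Λ Λ × b ∈Λ Λ × a < c × b < c × a + b ≡ i

SigmaBit : NumericalSemigroup → ℕ → ℕ → Set
SigmaBit Λ c i = ¬ InLeftSumset Λ c i

module Submission where

open import Defs
open import Data.Nat using (ℕ; zero; suc; _+_; _∸_; _<_; _≤_; z≤n; s≤s; s≤s⁻¹)
open import Data.Nat.Properties
open import Data.Bool using (true; false)
open import Data.Bool.Properties using (not-¬; ¬-not)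
open import Data.Product using (∃; _×_; _,_; Σ; proj₁; proj₂)
open import Data.Sum using (inj₁; inj₂)
open import Data.Empty using (⊥-elim)
open import Relation.Nullary using (¬_)
open import Relation.Binary.PropositionalEquality
open import Function.Bundles using (_⇔_; mk⇔; Equivalence)

-- Below the conductor, L + L coincides with Λ, because 0 is a left element.
-- Above it, fix i < c and λ_j ≤ i < λ_{j+1}.  If y + z = c + i with z < c
-- then i < y, so λ_j < y; hence the decompositions of c + i into two left
-- elements y ≤ z are exactly the sums λ_p + λ_q (j < p ≤ q) that the seed
-- condition for c + i − λ_j forbids.

u+v≡c+i∧v<c⇒i<u : ∀ {c i u v} → u + v ≡ c + i → v < c → i < u
u+v≡c+i∧v<c⇒i<u {c} {i} {u} {v} u+v≡c+i v<c with ≤-<-connex u i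
... | inj₂ i<u = i<u
... | inj₁ u≤i = ⊥-elim (<-irrefl (trans u+v≡c+i (+-comm c i)) (+-mono-≤-< u≤i v<c))

u+v≡c+i∧i<u⇒v<c : ∀ {c i u v} → u + v ≡ c + i → i < u → v < c
u+v≡c+i∧i<u⇒v<c {c} {i} {u} {v} u+v≡c+i i<u with ≤-<-connex c v
... | inj₂ v<c = v<c
... | inj₁ c≤v = ⊥-elim (<-irrefl (trans (+-comm i c) (sym u+v≡c+i)) (+-mono-<-≤ i<u c≤v))

module Elements (Λ : NumericalSemigroup) where

  NoElementBetween : ℕ → ℕ → Set
  NoElementBetween a b = ∀ m → a < m → m < b → mem Λ m ≡ false

  countBelow-suc-∈ : ∀ {x} → x ∈Λ Λ → countBelow Λ (suc x) ≡ suc (countBelow Λ x)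
  countBelow-suc-∈ x∈Λ rewrite x∈Λ = refl

  countBelow-suc-∉ : ∀ {x} → mem Λ x ≡ false → countBelow Λ (suc x) ≡ countBelow Λ x
  countBelow-suc-∉ x∉Λ rewrite x∉Λ = refl

  countBelow-≤-suc : ∀ x → countBelow Λ x ≤ countBelow Λ (suc x)
  countBelow-≤-suc x with mem Λ x
  ... | true  = n≤1+n _
  ... | false = ≤-refl

  countBelow-mono-≤ : ∀ {u v} → u ≤ v → countBelow Λ u ≤ countBelow Λ v
  countBelow-mono-≤ {v = zero}  z≤n = ≤-refl
  countBelow-mono-≤ {v = suc v} u≤1+v with m≤n⇒m<n∨m≡n u≤1+v
  ... | inj₁ u<1+v = ≤-trans (countBelow-mono-≤ (s≤s⁻¹ u<1+v)) (countBelow-≤-suc v)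
  ... | inj₂ refl  = ≤-refl

  countBelow-mono-< : ∀ {u v} → u ∈Λ Λ → u < v → countBelow Λ u < countBelow Λ v
  countBelow-mono-< u∈Λ u<v =
    subst (_≤ _) (countBelow-suc-∈ u∈Λ) (countBelow-mono-≤ u<v)

  countBelow-skip : ∀ {u v} → u ≤ v → (∀ m → u ≤ m → m < v → mem Λ m ≡ false) →
                    countBelow Λ v ≡ countBelow Λ u
  countBelow-skip {v = zero}  z≤n _ = refl
  countBelow-skip {v = suc v} u≤1+v gaps with m≤n⇒m<n∨m≡n u≤1+v
  ... | inj₂ refl  = refl
  ... | inj₁ u<1+v = trans (countBelow-suc-∉ (gaps v (s≤s⁻¹ u<1+v) ≤-refl))
                           (countBelow-skip (s≤s⁻¹ u<1+v) (λ m u≤m m<v → gaps m u≤m (m<n⇒m<1+n m<v)))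

  countBelow+gapsBelow : ∀ n → countBelow Λ n + gapsBelow Λ n ≡ n
  countBelow+gapsBelow zero = refl
  countBelow+gapsBelow (suc n) with mem Λ n
  ... | true  = cong suc (countBelow+gapsBelow n)
  ... | false = trans (+-suc _ _) (cong suc (countBelow+gapsBelow n))

  rank≡countBelow : ∀ c → rank Λ c ≡ countBelow Λ c
  rank≡countBelow c = begin
    c ∸ gapsBelow Λ c                                  ≡⟨ cong (_∸ gapsBelow Λ c) (countBelow+gapsBelow c) ⟨
    countBelow Λ c + gapsBelow Λ c ∸ gapsBelow Λ c     ≡⟨ m+n∸n≡m (countBelow Λ c) (gapsBelow Λ c) ⟩
    countBelow Λ c                                     ∎
    where open ≡-Reasoning

  Nth-mono-≤ : ∀ {p q u v} → Nth Λ p u → Nth Λ q v → p ≤ q → u ≤ v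
  Nth-mono-≤ (_ , refl) (v∈Λ , refl) p≤q with ≤-<-connex _ _
  ... | inj₁ u≤v = u≤v
  ... | inj₂ v<u = ⊥-elim (<⇒≱ (countBelow-mono-< v∈Λ v<u) p≤q)

  Nth-unique : ∀ {p u v} → Nth Λ p u → Nth Λ p v → u ≡ v
  Nth-unique λp≡u λp≡v = ≤-antisym (Nth-mono-≤ λp≡u λp≡v ≤-refl) (Nth-mono-≤ λp≡v λp≡u ≤-refl)

  Nth-suc : ∀ {j a b} → Nth Λ j a → b ∈Λ Λ → a < b → NoElementBetween a b → Nth Λ (suc j) b
  Nth-suc (a∈Λ , refl) b∈Λ a<b none =
    b∈Λ , trans (countBelow-skip a<b none) (countBelow-suc-∈ a∈Λ)

  greatestElement≤ : ∀ n → Σ ℕ λ a → a ∈Λ Λ × a ≤ n × NoElementBetween a (suc n)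
  greatestElement≤ zero = 0 , mem-0 Λ , z≤n , λ m 0<m m<1 → ⊥-elim (<⇒≱ 0<m (s≤s⁻¹ m<1))
  greatestElement≤ (suc n) with mem Λ (suc n) in n+1∈?
  ... | true  = suc n , n+1∈? , ≤-refl , λ m n+1<m m<n+2 → ⊥-elim (<⇒≱ n+1<m (s≤s⁻¹ m<n+2))
  ... | false with greatestElement≤ n
  ... | a , a∈Λ , a≤n , none = a , a∈Λ , m≤n⇒m≤1+n a≤n , none′
    where
    none′ : NoElementBetween a (suc (suc n))
    none′ m a<m m<n+2 with m≤n⇒m<n∨m≡n (s≤s⁻¹ m<n+2)
    ... | inj₁ m<n+1 = none m a<m m<n+1
    ... | inj₂ refl  = n+1∈?

  leastElement> : ∀ {i n} → i < n → n ∈Λ Λ → Σ ℕ λ b → b ∈Λ Λ × i < b × NoElementBetween i b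
  leastElement> {i} {n} i<n n∈Λ = search (n ∸ suc i) i (subst (_∈Λ Λ) n≡ n∈Λ)
    where
    n≡ : n ≡ suc (n ∸ suc i + i)
    n≡ = trans (sym (m∸n+n≡m i<n)) (+-suc _ i)
    search : ∀ d i → suc (d + i) ∈Λ Λ → Σ ℕ λ b → b ∈Λ Λ × i < b × NoElementBetween i b
    search zero i i+1∈Λ = suc i , i+1∈Λ , ≤-refl , λ m i<m m<i+1 → ⊥-elim (<⇒≱ i<m (s≤s⁻¹ m<i+1))
    search (suc d) i d+i+2∈Λ with mem Λ (suc i) in i+1∈?
    ... | true  = suc i , i+1∈? , ≤-refl , λ m i<m m<i+1 → ⊥-elim (<⇒≱ i<m (s≤s⁻¹ m<i+1))
    ... | false with search d (suc i) (subst (_∈Λ Λ) (cong suc (sym (+-suc d i))) d+i+2∈Λ)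
    ... | b , b∈Λ , i+1<b , none = b , b∈Λ , <-trans (n<1+n i) i+1<b , none′
      where
      none′ : NoElementBetween i b
      none′ m i<m m<b with m≤n⇒m<n∨m≡n i<m
      ... | inj₁ i+1<m = none m i+1<m m<b
      ... | inj₂ refl  = i+1∈?

  consecutiveAround : ∀ {i n} → i < n → n ∈Λ Λ →
    Σ ℕ λ j → Σ ℕ λ a → Σ ℕ λ b → Nth Λ j a × Nth Λ (suc j) b × a ≤ i × i < b
  consecutiveAround {i} i<n n∈Λ with greatestElement≤ i | leastElement> i<n n∈Λ
  ... | a , a∈Λ , a≤i , noneA | b , b∈Λ , i<b , noneB =
    countBelow Λ a , a , b , (a∈Λ , refl) , Nth-suc (a∈Λ , refl) b∈Λ (≤-<-trans a≤i i<b) none , a≤i , i<b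
    where
    none : NoElementBetween a b
    none m a<m m<b with ≤-<-connex m i
    ... | inj₁ m≤i = noneA m a<m (s≤s m≤i)
    ... | inj₂ i<m = noneB m i<m m<b

module LeftSumset (Λ : NumericalSemigroup) (c : ℕ) where
  open Elements Λ

  OrderedLeftSum : ℕ → Set
  OrderedLeftSum n = Σ ℕ λ y → Σ ℕ λ z → y ∈Λ Λ × z ∈Λ Λ × y ≤ z × z < c × y + z ≡ n

  InLeftSumset⇔OrderedLeftSum : ∀ n → InLeftSumset Λ c n ⇔ OrderedLeftSum n
  InLeftSumset⇔OrderedLeftSum n = mk⇔ order forget
    where
    order : InLeftSumset Λ c n → OrderedLeftSum n
    order (a , b , a∈Λ , b∈Λ , a<c , b<c , a+b≡n) with ≤-total a b
    ... | inj₁ a≤b = a , b , a∈Λ , b∈Λ , a≤b , b<c , a+b≡n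
    ... | inj₂ b≤a = b , a , b∈Λ , a∈Λ , b≤a , a<c , trans (+-comm b a) a+b≡n
    forget : OrderedLeftSum n → InLeftSumset Λ c n
    forget (y , z , y∈Λ , z∈Λ , y≤z , z<c , y+z≡n) =
      y , z , y∈Λ , z∈Λ , ≤-<-trans y≤z z<c , z<c , y+z≡n

  InLeftSumset⇔∈ : ∀ {n} → 0 < c → n < c → InLeftSumset Λ c n ⇔ n ∈Λ Λ
  InLeftSumset⇔∈ {n} 0<c n<c = mk⇔ sum∈Λ (λ n∈Λ → n , 0 , n∈Λ , mem-0 Λ , n<c , 0<c , +-identityʳ n)
    where
    sum∈Λ : InLeftSumset Λ c n → n ∈Λ Λ
    sum∈Λ (a , b , a∈Λ , b∈Λ , _ , _ , refl) = mem-+ Λ a b a∈Λ b∈Λ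

  seed⇒∉LeftSumset : ∀ {i j a} → Nth Λ j a → a ≤ i →
                     OrderSeed Λ c j (c + i ∸ a) → ¬ InLeftSumset Λ c (c + i)
  seed⇒∉LeftSumset {i} {j} {a} λj≡a a≤i (_ , x∈Λ , c≤x , unbalanced) sum
    with Equivalence.to (InLeftSumset⇔OrderedLeftSum (c + i)) sum
  ... | y , z , y∈Λ , z∈Λ , y≤z , z<c , y+z≡c+i =
    unbalanced _ a _ _ y z (x∈Λ , refl) λj≡a (y∈Λ , refl) (z∈Λ , refl)
      (subst (_< _) (proj₂ λj≡a) (countBelow-mono-< (proj₁ λj≡a) a<y))
      (countBelow-mono-≤ y≤z)
      (countBelow-mono-< z∈Λ (<-≤-trans z<c c≤x))
      (trans (m∸n+n≡m (≤-trans a≤i (m≤n+m i c))) (sym y+z≡c+i))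
    where
    a<y : a < y
    a<y = ≤-<-trans a≤i (u+v≡c+i∧v<c⇒i<u y+z≡c+i z<c)

  ∉LeftSumset⇒seed : ∀ {i j a b} → (∀ n → c ≤ n → n ∈Λ Λ) → i < c →
                     Nth Λ j a → Nth Λ (suc j) b → a ≤ i → i < b →
                     ¬ InLeftSumset Λ c (c + i) → OrderSeed Λ c j (c + i ∸ a)
  ∉LeftSumset⇒seed {i} {j} {a} cond i<c λj≡a@(a∈Λ , refl) λj+1≡b a≤i i<b ∉sum =
    j<rank , cond _ c≤x , c≤x , unbalanced
    where
    j<rank : j < rank Λ c
    j<rank = subst (j <_) (sym (rank≡countBelow c)) (countBelow-mono-< a∈Λ (≤-<-trans a≤i i<c))
    c≤x : c ≤ c + i ∸ a
    c≤x = subst (c ≤_) (sym (+-∸-assoc c a≤i)) (m≤m+n c (i ∸ a))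
    unbalanced : ∀ s a′ p q y z → Nth Λ s (c + i ∸ a) → Nth Λ j a′ → Nth Λ p y → Nth Λ q z →
                 j < p → p ≤ q → q < s → c + i ∸ a + a′ ≢ y + z
    unbalanced _ a′ _ _ y z _ λj≡a′ λp≡y λq≡z j<p p≤q _ x+a′≡y+z =
      ∉sum (Equivalence.from (InLeftSumset⇔OrderedLeftSum (c + i))
             (y , z , proj₁ λp≡y , proj₁ λq≡z , y≤z , z<c , y+z≡c+i))
      where
      y+z≡c+i : y + z ≡ c + i
      y+z≡c+i = begin
        y + z              ≡⟨ x+a′≡y+z ⟨
        c + i ∸ a + a′     ≡⟨ cong (c + i ∸ a +_) (Nth-unique λj≡a′ λj≡a) ⟩
        c + i ∸ a + a      ≡⟨ m∸n+n≡m (≤-trans a≤i (m≤n+m i c)) ⟩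
        c + i              ∎
        where open ≡-Reasoning
      y≤z : y ≤ z
      y≤z = Nth-mono-≤ λp≡y λq≡z p≤q
      z<c : z < c
      z<c = u+v≡c+i∧i<u⇒v<c y+z≡c+i (<-≤-trans i<b (Nth-mono-≤ λj+1≡b λp≡y j<p))

mainTheorem2 : (Λ : NumericalSemigroup) → (∃ λ n → mem Λ n ≡ false) →
    (c : ℕ) → IsConductor Λ c →
    (∀ i → i < c ∸ 1 → (GapBit Λ i ⇔ SigmaBit Λ c (suc i)))
    × ¬ GapBit Λ (c ∸ 1)
    × (∀ i → i < c → (SeedBit Λ c i ⇔ SigmaBit Λ c (c + i)))
mainTheorem2 Λ _ .(suc g) (g , _ , refl , cond) = gapBits , not-¬ (cond (suc g) ≤-refl) , seedBits
  where
  open Elements Λ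
  open LeftSumset Λ (suc g)

  gapBits : ∀ i → i < g → (GapBit Λ i ⇔ SigmaBit Λ (suc g) (suc i))
  gapBits i i<g = mk⇔ (λ i+1∉Λ sum → not-¬ i+1∉Λ (Equivalence.to sum⇔∈ sum))
                      (λ ∉sum → ¬-not (λ i+1∈Λ → ∉sum (Equivalence.from sum⇔∈ i+1∈Λ)))
    where
    sum⇔∈ : InLeftSumset Λ (suc g) (suc i) ⇔ suc i ∈Λ Λ
    sum⇔∈ = InLeftSumset⇔∈ (s≤s z≤n) (s≤s i<g)

  seedBits : ∀ i → i < suc g → (SeedBit Λ (suc g) i ⇔ SigmaBit Λ (suc g) (suc g + i))
  seedBits i i<c = mk⇔ (λ (_ , _ , _ , λj≡a , _ , a≤i , _ , seed) → seed⇒∉LeftSumset λj≡a a≤i seed)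
                       seedOf
    where
    seedOf : SigmaBit Λ (suc g) (suc g + i) → SeedBit Λ (suc g) i
    seedOf ∉sum with consecutiveAround i<c (cond (suc g) ≤-refl)
    ... | j , a , b , λj≡a , λj+1≡b , a≤i , i<b =
      j , a , b , λj≡a , λj+1≡b , a≤i , i<b , ∉LeftSumset⇒seed cond i<c λj≡a λj+1≡b a≤i i<b ∉sum
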